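{- Let $\mu\in\mathcal H$ with $\Re(\mu)=0$ and $m=N(\mu)$ squarefree; let $r=1$ if $m\not\equiv 3\pmod 4$ and $r=2$ if $m\equiv 3\pmod 4$, and $\omega=(r-1+\mu)/r$. If a primitive ideal $[a,b+\omega]$ of $\mathcal O(\mu)$ has right pseudo generator $\rho$ (so $[a,b+\omega]=R_\mu(\rho)$), and $\xi\in\mathcal H$ satisfies $b+\omega=\xi\rho$, then $$(\omega,\rho)+\Re(\rho)\left(b+\frac{r-1}{r}\right)=\Re(\xi)N(\rho).$$
   Context: Quaternions with Hamilton multiplication; $\Re(q)$ real part, $N(q)$ the norm. $\mathcal H$ = Hurwitz integral quaternions $(a+bi+cj+dk)/2$, $a,b,c,d\in\mathbb Z$ of equal parity. $\mathcal O(\mu)=\mathbb Z+\mathbb Z\omega$, a commutative subring of $\mathcal H$. A primitive ideal of $\mathcal O(\mu)$ is one with $\mathbb Z$-basis $[a,b+\omega]$, $a>0$, $b\in\mathbb Z$; its right pseudo generator is $\rho=\gcd_r(a,b+\omega)$, a greatest-norm common right divisor in $\mathcal H$ (unique up to a unit on the left); then $N(\rho)=a$ and $[a,b+\omega]=R_\mu(\rho):=\{\eta\rho:\eta\in\mathcal H,\ \eta\rho\in\mathcal O(\mu)\}$. The scalar product of $q=t_0+x_0i+y_0j+z_0k$ and $s=t_1+x_1i+y_1j+z_1k$ is $(q,s)=x_0x_1+y_0y_1+z_0z_1$. -}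

module Defs where

open import Data.Nat as ℕ using (ℕ; zero; suc)
open import Data.Nat.DivMod using (_%_)
open import Data.Nat.Divisibility as ℕD using ()
open import Data.Integer as ℤ using (ℤ; +_)
open import Data.Integer.Divisibility as ℤD using ()
open import Data.Rational as ℚ using (ℚ; _/_)
open import Data.Product using (Σ; _×_; _,_; ∃)
open import Relation.Binary.PropositionalEquality using (_≡_)
open import Relation.Nullary using (yes; no)

record ℍ : Set where
  constructor ⟨_,_,_,_⟩
  field
    re : ℚ
    qi : ℚ
    qj : ℚ
    qk : ℚ
open ℍ public

infixl 6 _+ₕ_
infixl 7 _*ₕ_

_+ₕ_ : ℍ → ℍ → ℍ
⟨ a , b , c , d ⟩ +ₕ ⟨ e , f , g , h ⟩ =
  ⟨ a ℚ.+ e , b ℚ.+ f , c ℚ.+ g , d ℚ.+ h ⟩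

_*ₕ_ : ℍ → ℍ → ℍ
⟨ a₁ , b₁ , c₁ , d₁ ⟩ *ₕ ⟨ a₂ , b₂ , c₂ , d₂ ⟩ =
  ⟨ a₁ ℚ.* a₂ ℚ.- b₁ ℚ.* b₂ ℚ.- c₁ ℚ.* c₂ ℚ.- d₁ ℚ.* d₂
  , a₁ ℚ.* b₂ ℚ.+ b₁ ℚ.* a₂ ℚ.+ c₁ ℚ.* d₂ ℚ.- d₁ ℚ.* c₂
  , a₁ ℚ.* c₂ ℚ.- b₁ ℚ.* d₂ ℚ.+ c₁ ℚ.* a₂ ℚ.+ d₁ ℚ.* b₂
  , a₁ ℚ.* d₂ ℚ.+ b₁ ℚ.* c₂ ℚ.- c₁ ℚ.* b₂ ℚ.+ d₁ ℚ.* a₂ ⟩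

ofℚ : ℚ → ℍ
ofℚ q = ⟨ q , ℚ.0ℚ , ℚ.0ℚ , ℚ.0ℚ ⟩

ofℤ : ℤ → ℍ
ofℤ n = ofℚ (n / 1)

Re : ℍ → ℚ
Re = re

N : ℍ → ℚ
N ⟨ a , b , c , d ⟩ = a ℚ.* a ℚ.+ b ℚ.* b ℚ.+ c ℚ.* c ℚ.+ d ℚ.* d

⟪_,_⟫ : ℍ → ℍ → ℚ
⟪ ⟨ _ , x₀ , y₀ , z₀ ⟩ , ⟨ _ , x₁ , y₁ , z₁ ⟩ ⟫ =
  x₀ ℚ.* x₁ ℚ.+ y₀ ℚ.* y₁ ℚ.+ z₀ ℚ.* z₁

IsHurwitz : ℍ → Set
IsHurwitz q = Σ ℤ λ a → Σ ℤ λ b → Σ ℤ λ c → Σ ℤ λ d →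
  (+ 2 ℤD.∣ a ℤ.- b) × (+ 2 ℤD.∣ a ℤ.- c) × (+ 2 ℤD.∣ a ℤ.- d) ×
  (q ≡ ⟨ a / 2 , b / 2 , c / 2 , d / 2 ⟩)

Squarefree : ℕ → Set
Squarefree m = (d : ℕ) → (d ℕ.* d) ℕD.∣ m → d ≡ 1

rPred : ℕ → ℕ
rPred m with m % 4 ℕ.≟ 3
... | yes _ = 1
... | no _ = 0

rOf : ℕ → ℕ
rOf m = suc (rPred m)

ω : ℕ → ℍ → ℍ
ω m μ = ofℚ (+ 1 / rOf m) *ₕ (ofℚ (+ rPred m / 1) +ₕ μ)

_∣ʳ_ : ℍ → ℍ → Set
σ ∣ʳ α = Σ ℍ λ η → IsHurwitz η × (α ≡ η *ₕ σ)

IsRightGcd : ℍ → ℍ → ℍ → Set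
IsRightGcd ρ α β =
  IsHurwitz ρ × ρ ∣ʳ α × ρ ∣ʳ β ×
  ((σ : ℍ) → IsHurwitz σ → σ ∣ʳ α → σ ∣ʳ β → N σ ℚ.≤ N ρ)

_∈[_,_] : ℍ → ℍ → ℍ → Set
γ ∈[ α , β ] = Σ ℤ λ x → Σ ℤ λ y → γ ≡ ofℤ x *ₕ α +ₕ ofℤ y *ₕ β

-- [a, b+ω] is an ideal of 𝓞(μ) = ℤ + ℤω: closed under multiplication by 𝓞(μ)
IsPrimitiveIdeal : ℕ → ℍ → ℕ → ℤ → Set
IsPrimitiveIdeal m μ a b =
  (0 ℕ.< a) ×
  ((u v x y : ℤ) →
    ((ofℤ u +ₕ ofℤ v *ₕ ω m μ) *ₕ
       (ofℤ x *ₕ ofℤ (+ a) +ₕ ofℤ y *ₕ (ofℤ b +ₕ ω m μ)))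
      ∈[ ofℤ (+ a) , ofℤ b +ₕ ω m μ ])

-- Since ξρρ̄ = ξ N(ρ), the real part of (ξρ)ρ̄ is Re(ξ) N(ρ); expanding the left side gives
-- (ξρ, ρ) + Re(ξρ) Re(ρ).  With ξρ = b + ω the scalar product only sees the imaginary part ω,
-- and Re(b + ω) = b + (r − 1)/r because μ is pure.
module Submission where

open import Defs
open import Data.Nat using (ℕ)
open import Data.Nat.DivMod using (_%_)
import Data.Nat as ℕ
open import Data.Integer using (ℤ; +_)
open import Data.Rational using (ℚ; _/_; _+_; _*_; _-_; 0ℚ)
open import Data.Rational.Properties using (+-*-commutativeRing; +-identityˡ; *-zeroˡ; _≟_)
open import Relation.Binary.PropositionalEquality
open import Relation.Nullary using (yes; no)
open import Data.Maybe using (Maybe; just; nothing)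
open import Tactic.RingSolver using (solve-∀)
open import Tactic.RingSolver.Core.AlmostCommutativeRing using (AlmostCommutativeRing; fromCommutativeRing)

ℚ-almostCommutativeRing : AlmostCommutativeRing _ _
ℚ-almostCommutativeRing = fromCommutativeRing +-*-commutativeRing isZero?
  where
  isZero? : ∀ x → Maybe (0ℚ ≡ x)
  isZero? x with 0ℚ ≟ x
  ... | yes p = just p
  ... | no _ = nothing

⟪*ρ,ρ⟫+Re*Re≡Re*N : ∀ ξ ρ → ⟪ ξ *ₕ ρ , ρ ⟫ + Re ρ * Re (ξ *ₕ ρ) ≡ Re ξ * N ρ
⟪*ρ,ρ⟫+Re*Re≡Re*N ⟨ x₀ , x₁ , x₂ , x₃ ⟩ ⟨ p₀ , p₁ , p₂ , p₃ ⟩ = identity x₀ x₁ x₂ x₃ p₀ p₁ p₂ p₃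
  where
  identity : ∀ x₀ x₁ x₂ x₃ p₀ p₁ p₂ p₃ →
    (x₀ * p₁ + x₁ * p₀ + x₂ * p₃ - x₃ * p₂) * p₁
      + (x₀ * p₂ - x₁ * p₃ + x₂ * p₀ + x₃ * p₁) * p₂
      + (x₀ * p₃ + x₁ * p₂ - x₂ * p₁ + x₃ * p₀) * p₃
      + p₀ * (x₀ * p₀ - x₁ * p₁ - x₂ * p₂ - x₃ * p₃)
    ≡ x₀ * (p₀ * p₀ + p₁ * p₁ + p₂ * p₂ + p₃ * p₃)
  identity = solve-∀ ℚ-almostCommutativeRing

⟪ofℚ+,⟫ : ∀ q α ρ → ⟪ ofℚ q +ₕ α , ρ ⟫ ≡ ⟪ α , ρ ⟫
⟪ofℚ+,⟫ q α ρ
  rewrite +-identityˡ (qi α) | +-identityˡ (qj α) | +-identityˡ (qk α) = refl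

Re-ω : ∀ m μ → Re μ ≡ 0ℚ → Re (ω m μ) ≡ + rPred m / rOf m
Re-ω m μ Re-μ≡0 with m % 4 ℕ.≟ 3
... | yes _ rewrite Re-μ≡0 | *-zeroˡ (0ℚ + qi μ) | *-zeroˡ (0ℚ + qj μ) | *-zeroˡ (0ℚ + qk μ) = refl
... | no _  rewrite Re-μ≡0 | *-zeroˡ (0ℚ + qi μ) | *-zeroˡ (0ℚ + qj μ) | *-zeroˡ (0ℚ + qk μ) = refl

proposition3 : (μ : ℍ) → IsHurwitz μ → Re μ ≡ 0ℚ →
    (m : ℕ) → N μ ≡ + m / 1 → Squarefree m →
    (a : ℕ) (b : ℤ) → IsPrimitiveIdeal m μ a b →
    (ρ : ℍ) → IsRightGcd ρ (ofℤ (+ a)) (ofℤ b +ₕ ω m μ) →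
    (ξ : ℍ) → IsHurwitz ξ → ofℤ b +ₕ ω m μ ≡ ξ *ₕ ρ →
    ⟪ ω m μ , ρ ⟫ + Re ρ * (b / 1 + (+ rPred m) / rOf m) ≡ Re ξ * N ρ
proposition3 μ _ Re-μ≡0 m _ _ a b _ ρ _ ξ _ b+ω≡ξρ = begin
  ⟪ ω m μ , ρ ⟫ + Re ρ * (b / 1 + + rPred m / rOf m)
    ≡⟨ cong₂ (λ s t → s + Re ρ * (b / 1 + t))
         (sym (⟪ofℚ+,⟫ (b / 1) (ω m μ) ρ)) (sym (Re-ω m μ Re-μ≡0)) ⟩
  ⟪ ofℤ b +ₕ ω m μ , ρ ⟫ + Re ρ * Re (ofℤ b +ₕ ω m μ)
    ≡⟨ cong (λ α → ⟪ α , ρ ⟫ + Re ρ * Re α) b+ω≡ξρ ⟩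
  ⟪ ξ *ₕ ρ , ρ ⟫ + Re ρ * Re (ξ *ₕ ρ)
    ≡⟨ ⟪*ρ,ρ⟫+Re*Re≡Re*N ξ ρ ⟩
  Re ξ * N ρ ∎
  where open ≡-Reasoning
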